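{- Let $L$ be an agreeable pseudo-hitomezashi loop (with respect to $i_0$) with at least one location where a split can be performed, and let $L_1$ and $L_2$ be the pseudo-hitomezashi strands into which $L$ breaks when this split is applied. Then $L_1$ and $L_2$ are agreeable pseudo-hitomezashi loops, and neither is contained in the interior of the other.
   Context: A hitomezashi pattern $H$ is determined by labels $\epsilon_i\in\{0,1\}$ ($i\in\mathbb Z$) and $\eta_j\in\{0,1\}$ ($j\in\mathbb Z$): its vertical stitches are the unit segments from $(i,j)$ to $(i,j+1)$ with $j\equiv\epsilon_i\pmod 2$, and its horizontal stitches are the unit segments from $(i,j)$ to $(i+1,j)$ with $i\equiv \eta_j\pmod 2$. The longitude/latitude of a unit segment are the $x$/$y$-coordinates of its midpoint. Fix $i_0\in\mathbb Z+\tfrac12$ and assume $\epsilon_{i_0-1/2}=\epsilon_{i_0+1/2}$. For each unit cell $[i_0-\tfrac12,i_0+\tfrac12]\times[j-\tfrac12,j+\tfrac12]$ whose left and right sides are both vertical stitches of $H$: if neither its top nor bottom side is a horizontal stitch of $H$, a local move replaces the left and right sides by the top and bottom sides; if both its top and bottom sides are stitches, a square deletion removes all four sides. A pseudo-hitomezashi path (with respect to $i_0$) is an embedded curve that is a union of segments of a configuration obtained from $H$ by applying some of these local moves and square deletions; a pseudo-hitomezashi loop is a closed one and a pseudo-hitomezashi strand is a maximal one. A local move (applied to the current configuration) is a split if the two vertical segments it removes lie in the same strand (and a splice otherwise). Loops are oriented counterclockwise (interior on the left). A pseudo-hitomezashi path is agreeable if each of its vertical segments at longitude $i_0-1/2$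 is oriented north-to-south and each at longitude $i_0+1/2$ is oriented south-to-north. -}

module Defs where

open import Data.Bool using (Bool; true; false; not; _∧_; if_then_else_)
open import Data.Nat using (ℕ; zero; suc; _≤_)
open import Data.Integer using (ℤ; +_; -[1+_]; _+_; _-_; 1ℤ)
open import Data.Integer.Properties using (_≟_; _<?_)
open import Data.Integer.Base using (_<_)
open import Data.Product using (Σ; _×_; _,_; proj₁; proj₂)
open import Data.Sum using (_⊎_)
open import Data.List using (List; []; _∷_; length)
open import Data.List.Relation.Unary.All using (All)
open import Data.List.Relation.Unary.Unique.Propositional using (Unique)
open import Data.List.Membership.Propositional using (_∈_; _∉_)
open import Relation.Nullary using (¬_; does)
open import Relation.Binary.PropositionalEquality using (_≡_)

oddℕ : ℕ → Bool
oddℕ zero    = false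
oddℕ (suc n) = not (oddℕ n)

oddℤ : ℤ → Bool
oddℤ (+ n)      = oddℕ n
oddℤ -[1+ n ]   = not (oddℕ n)

-- Hitomezashi patterns.  Labels in {0,1} are encoded as Bool
-- (false = 0, true = 1); "x ≡ label (mod 2)" is  oddℤ x ≡ label.

record Pattern : Set where
  field
    ε : ℤ → Bool
    η : ℤ → Bool
open Pattern public

-- Unit segments of the lattice ℤ².
--   vert i j : segment from (i,j) to (i,j+1)
--   horz i j : segment from (i,j) to (i+1,j)
data Seg : Set where
  vert : ℤ → ℤ → Seg
  horz : ℤ → ℤ → Seg

Stitch : Pattern → Seg → Set
Stitch H (vert i j) = oddℤ j ≡ ε H i
Stitch H (horz i j) = oddℤ i ≡ η H j

-- The column of cells at longitude i₀ = a + 1/2 (a = i₀ - 1/2 ∈ ℤ).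
-- The cell with latitude b + 1/2 is [a, a+1] × [b, b+1]; its
-- left, right, bottom, top sides are
--   vert a b, vert (a+1) b, horz a b, horz a (b+1).

MoveCell : Pattern → ℤ → ℤ → Set
MoveCell H a b =
  Stitch H (vert a b) × Stitch H (vert (a + 1ℤ) b) ×
  ¬ Stitch H (horz a b) × ¬ Stitch H (horz a (b + 1ℤ))

DelCell : Pattern → ℤ → ℤ → Set
DelCell H a b =
  Stitch H (vert a b) × Stitch H (vert (a + 1ℤ) b) ×
  Stitch H (horz a b) × Stitch H (horz a (b + 1ℤ))

record Choice (H : Pattern) (a : ℤ) : Set₁ where
  field
    M    : ℤ → Set
    D    : ℤ → Set
    M-ok : ∀ b → M b → MoveCell H a b
    D-ok : ∀ b → D b → DelCell H a b
open Choice public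

Removed : ∀ {H a} → Choice H a → Seg → Set
Removed {H} {a} c s = Σ ℤ λ b →
    (M c b × (s ≡ vert a b ⊎ s ≡ vert (a + 1ℤ) b))
  ⊎ (D c b × (s ≡ vert a b ⊎ s ≡ vert (a + 1ℤ) b ⊎
              s ≡ horz a b ⊎ s ≡ horz a (b + 1ℤ)))

Added : ∀ {H a} → Choice H a → Seg → Set
Added {H} {a} c s = Σ ℤ λ b → M c b × (s ≡ horz a b ⊎ s ≡ horz a (b + 1ℤ))

Config : ∀ {H a} → Choice H a → Seg → Set
Config {H} c s = (Stitch H s × ¬ Removed c s) ⊎ Added c s

addMove : ∀ {H a} → (c : Choice H a) → (b : ℤ) → MoveCell H a b → Choice H a
addMove c b mv = record
  { M    = λ b' → M c b' ⊎ b' ≡ b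
  ; D    = D c
  ; M-ok = λ { b' (Data.Sum.inj₁ m) → M-ok c b' m
             ; b' (Data.Sum.inj₂ Relation.Binary.PropositionalEquality.refl) → mv }
  ; D-ok = D-ok c
  }

Vertex : Set
Vertex = ℤ × ℤ

data Dir : Set where
  N E S W : Dir

step : Dir → Vertex → Vertex
step N (x , y) = (x , y + 1ℤ)
step S (x , y) = (x , y - 1ℤ)
step E (x , y) = (x + 1ℤ , y)
step W (x , y) = (x - 1ℤ , y)

segOf : Dir → Vertex → Seg
segOf N (x , y) = vert x y
segOf S (x , y) = vert x (y - 1ℤ)
segOf E (x , y) = horz x y
segOf W (x , y) = horz (x - 1ℤ) y

-- lower-left corner of the unit cell lying to the LEFT of the step
leftCell : Dir → Vertex → Vertex
leftCell N (x , y) = (x - 1ℤ , y)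
leftCell E (x , y) = (x , y)
leftCell S (x , y) = (x , y - 1ℤ)
leftCell W (x , y) = (x - 1ℤ , y - 1ℤ)

steps : Vertex → List Dir → List (Vertex × Dir)
steps v []       = []
steps v (d ∷ ds) = (v , d) ∷ steps (step d v) ds

verts : Vertex → List Dir → List Vertex
verts v []       = []
verts v (d ∷ ds) = v ∷ verts (step d v) ds

segs : Vertex → List Dir → List Seg
segs v []       = []
segs v (d ∷ ds) = segOf d v ∷ segs (step d v) ds

endpoint : Vertex → List Dir → Vertex
endpoint v []       = v
endpoint v (d ∷ ds) = endpoint (step d v) ds

-- The cell with lower-left corner (x,y) has centre (x+1/2, y+1/2); the
-- horizontal ray from the centre to the east crosses exactly the
-- vertical segments  vert i y  with x < i.

crossings : Vertex → List Seg → ℕ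
crossings p [] = 0
crossings (x , y) (vert i j ∷ ss) =
  if does (j ≟ y) ∧ does (x <? i)
  then suc (crossings (x , y) ss) else crossings (x , y) ss
crossings p (horz i j ∷ ss) = crossings p ss

InteriorCell : List Seg → Vertex → Set
InteriorCell ss p = oddℕ (crossings p ss) ≡ true

-- Pseudo-hitomezashi loops in a configuration C: embedded closed
-- lattice curves made of segments of C, given by a start vertex and
-- the list of steps, oriented counterclockwise (interior on the left).

record Loop (C : Seg → Set) : Set where
  field
    start    : Vertex
    dirs     : List Dir
    long     : 3 ≤ length dirs
    closed   : endpoint start dirs ≡ start
    embedded : Unique (verts start dirs)
    inC      : All C (segs start dirs)
    ccw      : All (λ vd → InteriorCell (segs start dirs)
                               (leftCell (proj₂ vd) (proj₁ vd)))
                   (steps start dirs)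
open Loop public

loopSegs : ∀ {C} → Loop C → List Seg
loopSegs L = segs (start L) (dirs L)

loopVerts : ∀ {C} → Loop C → List Vertex
loopVerts L = verts (start L) (dirs L)

Agreeable : ∀ {C} → ℤ → Loop C → Set
Agreeable a L = All (λ vd →
    (∀ j → segOf (proj₂ vd) (proj₁ vd) ≡ vert a j → proj₂ vd ≡ S) ×
    (∀ j → segOf (proj₂ vd) (proj₁ vd) ≡ vert (a + 1ℤ) j → proj₂ vd ≡ N))
  (steps (start L) (dirs L))

InteriorPt : ∀ {C} → Loop C → Vertex → Set
InteriorPt L p = p ∉ loopVerts L × InteriorCell (loopSegs L) p

-- L₁ is contained in the interior of L₂ (every vertex of L₁ is an
-- interior point of L₂; sufficient for lattice curves)
InInterior : ∀ {C C'} → Loop C → Loop C' → Set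
InInterior L₁ L₂ = All (InteriorPt L₂) (loopVerts L₁)

-- Agreeability makes L run down the left side and up the right side of the cell, so read from
-- the lower-left corner it is P · N · Q · S, with P ending at the lower-right and Q at the
-- upper-left corner; the split closes P along the bottom and Q along the top.  Insideness is
-- decided by the parity of crossings of an eastward ray.  Modulo 2, L is the sum of the two new
-- loops and the boundary of the cell, which encloses exactly that cell.  P never meets the
-- closed-up Q, so the parity of Q is constant on the cells to the left of P, and vice versa;
-- at the rightmost vertical segment of L, which a counterclockwise loop climbs, this constant is
-- seen to be 0.  Hence the cells left of P lie inside the closed-up P (it is counterclockwise),
-- likewise for Q, and each new loop has a vertex outside the other.
module Submission where

open import Defs
open import Data.Bool using (Bool; true; false; not; _∧_; _xor_)
open import Data.Bool.Properties
  using ( xor-comm; xor-assoc; xor-identityʳ; xor-same; ∧-distribˡ-xor; ∧-comm; ∧-zeroʳ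
        ; ¬-not; not-¬; not-involutive; xor-∧-commutativeRing )
open import Algebra.Bundles using (CommutativeRing)
open import Algebra.Properties.CommutativeSemigroup
  (CommutativeRing.+-commutativeSemigroup xor-∧-commutativeRing)
  using () renaming (interchange to xor-interchange)
open import Data.Nat as ℕ using (zero; suc; s≤s; z≤n)
import Data.Nat.Properties as ℕ
open import Data.Integer using (ℤ; +_; -[1+_]; _+_; _-_; 1ℤ; _<_; _≤_; _⊔_; pred)
open import Data.Integer.Properties as ℤ using (_≟_; _<?_)
open import Data.Integer.Tactic.RingSolver using (solve-∀)
open import Data.Product using (Σ; ∃; ∃₂; _×_; _,_; proj₁; proj₂)
open import Data.Product.Properties using (,-injective)
open import Data.Sum using (_⊎_; inj₁; inj₂)
open import Data.Empty using (⊥-elim)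
open import Function using (_∘′_; mk⇔)
open import Relation.Nullary using (¬_; does; yes; no)
open import Relation.Nullary.Decidable using (does-⇔; dec-true)
open import Relation.Binary.PropositionalEquality hiding ([_])
open import Data.List using (List; []; _∷_; _++_; [_]; map; length)
open import Data.List.Properties using (length-++; length-++-comm; ++-assoc)
open import Data.List.Relation.Unary.All using (All; []; _∷_)
import Data.List.Relation.Unary.All as All
open import Data.List.Relation.Unary.All.Properties using (++⁺; ++⁻ˡ; ++⁻ʳ)
open import Data.List.Relation.Unary.Any using (here; there)
open import Data.List.Membership.Propositional using (_∈_; _∉_)
open import Data.List.Relation.Unary.Unique.Propositional using (Unique; []; _∷_)
open import Data.List.Relation.Binary.Disjoint.Propositional using (Disjoint)
open import Data.List.Relation.Binary.Permutation.Propositional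
  using (_↭_; ↭⇒↭ₛ; ↭-sym; ↭-trans; ↭-reflexive)
import Data.List.Relation.Binary.Permutation.Propositional as ↭
open import Data.List.Relation.Binary.Permutation.Propositional.Properties
  using (All-resp-↭; ∈-resp-↭; map⁺; ++-comm)
open import Data.List.Relation.Binary.Permutation.Setoid.Properties (setoid Vertex)
  using (Unique-resp-↭)
open import Data.List.Membership.Propositional.Properties
  using (∈-++⁺ˡ; ∈-++⁺ʳ; ∈-++⁻; ∈-map⁺; ∈-map⁻)

i+1-1≡i : ∀ i → i + 1ℤ - 1ℤ ≡ i
i+1-1≡i = solve-∀

i-1+1≡i : ∀ i → i - 1ℤ + 1ℤ ≡ i
i-1+1≡i = solve-∀

i-1≡j⇒i≡j+1 : ∀ {i j} → i - 1ℤ ≡ j → i ≡ j + 1ℤ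
i-1≡j⇒i≡j+1 {i} e = trans (sym (i-1+1≡i i)) (cong (_+ 1ℤ) e)

-1-injective : ∀ {i j} → i - 1ℤ ≡ j - 1ℤ → i ≡ j
-1-injective {j = j} e = trans (i-1≡j⇒i≡j+1 e) (i-1+1≡i j)

+1-injective : ∀ {i j} → i + 1ℤ ≡ j + 1ℤ → i ≡ j
+1-injective {i} {j} e = trans (sym (i+1-1≡i i)) (trans (cong (_- 1ℤ) e) (i+1-1≡i j))

i<i+1 : ∀ i → i < i + 1ℤ
i<i+1 i = ℤ.suc[i]≤j⇒i<j (ℤ.≤-reflexive (ℤ.+-comm 1ℤ i))

i≢i+1 : ∀ i → i ≢ i + 1ℤ
i≢i+1 i = ℤ.<⇒≢ (i<i+1 i)

i+1≢i : ∀ i → i + 1ℤ ≢ i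
i+1≢i i = i≢i+1 i ∘′ sym

i-1<i : ∀ i → i - 1ℤ < i
i-1<i i = subst (i - 1ℤ <_) (i-1+1≡i i) (i<i+1 (i - 1ℤ))

i-1≢i+1 : ∀ i → i - 1ℤ ≢ i + 1ℤ
i-1≢i+1 i = ℤ.<⇒≢ (ℤ.<-trans (i-1<i i) (i<i+1 i))

i+1+1≢i : ∀ i → i + 1ℤ + 1ℤ ≢ i
i+1+1≢i i = ℤ.<⇒≢ (ℤ.<-trans (i<i+1 i) (i<i+1 (i + 1ℤ))) ∘′ sym

<i+1⇒≤ : ∀ {i j} → i < j + 1ℤ → i ≤ j
<i+1⇒≤ {i} {j} i<j+1 =
  subst (i ≤_) (trans (cong pred (ℤ.+-comm j 1ℤ)) (ℤ.pred-suc j)) (ℤ.i<j⇒i≤pred[j] i<j+1)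

<-xor-<+1 : ∀ x i → does (x <? i) xor does (x <? i + 1ℤ) ≡ does (i ≟ x)
<-xor-<+1 x i with x <? i | x <? i + 1ℤ | i ≟ x
... | yes x<i | _         | yes refl = ⊥-elim (ℤ.<-irrefl refl x<i)
... | yes _   | yes _     | no _     = refl
... | yes x<i | no x≮i+1  | no _     = ⊥-elim (x≮i+1 (ℤ.<-trans x<i (i<i+1 i)))
... | no _    | yes _     | yes _    = refl
... | no x≮i  | yes x<i+1 | no i≢x   = ⊥-elim (x≮i (ℤ.≤∧≢⇒< (<i+1⇒≤ x<i+1) (i≢x ∘′ sym)))
... | no _    | no x≮x+1  | yes refl = ⊥-elim (x≮x+1 (i<i+1 x))
... | no _    | no _      | no _     = refl

does-≟-1 : ∀ i j → does (i ≟ j - 1ℤ) ≡ does (i + 1ℤ ≟ j)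
does-≟-1 i j = does-⇔ (mk⇔ (λ e → trans (cong (_+ 1ℤ) e) (i-1+1≡i j))
                            (λ e → trans (sym (i+1-1≡i i)) (cong (_- 1ℤ) e)))
                       (i ≟ j - 1ℤ) (i + 1ℤ ≟ j)

does-≟-pred : ∀ i j → does (i - 1ℤ ≟ j - 1ℤ) ≡ does (i ≟ j)
does-≟-pred i j = does-⇔ (mk⇔ -1-injective (cong (_- 1ℤ))) (i - 1ℤ ≟ j - 1ℤ) (i ≟ j)

xorMap : ∀ {A : Set} → (A → Bool) → List A → Bool
xorMap f []       = false
xorMap f (x ∷ xs) = f x xor xorMap f xs

module _ {A : Set} where

  xorMap-++ : ∀ (f : A → Bool) xs ys → xorMap f (xs ++ ys) ≡ xorMap f xs xor xorMap f ys
  xorMap-++ f []       ys = refl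
  xorMap-++ f (x ∷ xs) ys = trans (cong (f x xor_) (xorMap-++ f xs ys)) (sym (xor-assoc (f x) _ _))

  xorMap-xor : ∀ (f g : A → Bool) xs → xorMap (λ x → f x xor g x) xs ≡ xorMap f xs xor xorMap g xs
  xorMap-xor f g []       = refl
  xorMap-xor f g (x ∷ xs) =
    trans (cong ((f x xor g x) xor_) (xorMap-xor f g xs)) (xor-interchange (f x) (g x) _ _)

  xorMap-cong : ∀ {f g : A → Bool} {xs} → All (λ x → f x ≡ g x) xs → xorMap f xs ≡ xorMap g xs
  xorMap-cong []         = refl
  xorMap-cong (fx≡gx ∷ eqs) = cong₂ _xor_ fx≡gx (xorMap-cong eqs)

  xorMap-false : ∀ {f : A → Bool} {xs} → All (λ x → f x ≡ false) xs → xorMap f xs ≡ false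
  xorMap-false []         = refl
  xorMap-false (fx≡false ∷ eqs) = cong₂ _xor_ fx≡false (xorMap-false eqs)

  xorMap-↭ : ∀ (f : A → Bool) {xs ys} → xs ↭ ys → xorMap f xs ≡ xorMap f ys
  xorMap-↭ f ↭.refl           = refl
  xorMap-↭ f (↭.prep x p)     = cong (f x xor_) (xorMap-↭ f p)
  xorMap-↭ f (↭.swap {xs} {ys} x y p) = begin
    f x xor (f y xor xorMap f xs)  ≡⟨ sym (xor-assoc (f x) (f y) _) ⟩
    (f x xor f y) xor xorMap f xs  ≡⟨ cong₂ _xor_ (xor-comm (f x) (f y)) (xorMap-↭ f p) ⟩
    (f y xor f x) xor xorMap f ys  ≡⟨ xor-assoc (f y) (f x) _ ⟩
    f y xor (f x xor xorMap f ys)  ∎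
    where open ≡-Reasoning
  xorMap-↭ f (↭.trans p q)    = trans (xorMap-↭ f p) (xorMap-↭ f q)

xor≡false⇒≡ : ∀ {a b} → a xor b ≡ false → a ≡ b
xor≡false⇒≡ {false} {false} _ = refl
xor≡false⇒≡ {true}  {true}  _ = refl

xor-true≡true⇒≡false : ∀ {a} → a xor true ≡ true → a ≡ false
xor-true≡true⇒≡false {false} _ = refl

xor-telescope : ∀ a b c → (a xor b) xor (b xor c) ≡ a xor c
xor-telescope a b c = begin
  (a xor b) xor (b xor c)  ≡⟨ xor-assoc a b (b xor c) ⟩
  a xor (b xor (b xor c))  ≡⟨ cong (a xor_) (sym (xor-assoc b b c)) ⟩
  a xor ((b xor b) xor c)  ≡⟨ cong (λ t → a xor (t xor c)) (xor-same b) ⟩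
  a xor c                  ∎
  where open ≡-Reasoning

stepSeg : Vertex × Dir → Seg
stepSeg vd = segOf (proj₂ vd) (proj₁ vd)

stepLeftCell : Vertex × Dir → Vertex
stepLeftCell vd = leftCell (proj₂ vd) (proj₁ vd)

verts≡map-steps : ∀ u ds → verts u ds ≡ map proj₁ (steps u ds)
verts≡map-steps u []       = refl
verts≡map-steps u (d ∷ ds) = cong (u ∷_) (verts≡map-steps (step d u) ds)

segs≡map-steps : ∀ u ds → segs u ds ≡ map stepSeg (steps u ds)
segs≡map-steps u []       = refl
segs≡map-steps u (d ∷ ds) = cong (segOf d u ∷_) (segs≡map-steps (step d u) ds)

endpoint-++ : ∀ u xs ys → endpoint u (xs ++ ys) ≡ endpoint (endpoint u xs) ys
endpoint-++ u []       ys = refl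
endpoint-++ u (d ∷ xs) ys = endpoint-++ (step d u) xs ys

steps-++ : ∀ u xs ys → steps u (xs ++ ys) ≡ steps u xs ++ steps (endpoint u xs) ys
steps-++ u []       ys = refl
steps-++ u (d ∷ xs) ys = cong ((u , d) ∷_) (steps-++ (step d u) xs ys)

verts-++ : ∀ u xs ys → verts u (xs ++ ys) ≡ verts u xs ++ verts (endpoint u xs) ys
verts-++ u []       ys = refl
verts-++ u (d ∷ xs) ys = cong (u ∷_) (verts-++ (step d u) xs ys)

segs-++ : ∀ u xs ys → segs u (xs ++ ys) ≡ segs u xs ++ segs (endpoint u xs) ys
segs-++ u []       ys = refl
segs-++ u (d ∷ xs) ys = cong (segOf d u ∷_) (segs-++ (step d u) xs ys)

module _ {A : Set} (f : Vertex → List Dir → List A)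
         (f-++ : ∀ u xs ys → f u (xs ++ ys) ≡ f u xs ++ f (endpoint u xs) ys) where

  walk-decompose : ∀ u P d Q d′ → let v = endpoint u P; w = endpoint (step d v) Q in
    f u (P ++ d ∷ Q ++ [ d′ ]) ≡ f u P ++ f v [ d ] ++ f (step d v) Q ++ f w [ d′ ]
  walk-decompose u P d Q d′ = begin
    f u (P ++ d ∷ Q ++ [ d′ ])
      ≡⟨ f-++ u P (d ∷ Q ++ [ d′ ]) ⟩
    f u P ++ f v ([ d ] ++ Q ++ [ d′ ])
      ≡⟨ cong (f u P ++_) (f-++ v [ d ] (Q ++ [ d′ ])) ⟩
    f u P ++ f v [ d ] ++ f (step d v) (Q ++ [ d′ ])
      ≡⟨ cong (λ t → f u P ++ f v [ d ] ++ t) (f-++ (step d v) Q [ d′ ]) ⟩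
    f u P ++ f v [ d ] ++ f (step d v) Q ++ f (endpoint (step d v) Q) [ d′ ] ∎
    where
    open ≡-Reasoning
    v = endpoint u P

step-S≡ : ∀ {v x y} → step S v ≡ (x , y) → v ≡ (x , y + 1ℤ)
step-S≡ {x′ , y′} e with ,-injective e
... | refl , y′-1≡y = cong (x′ ,_) (i-1≡j⇒i≡j+1 y′-1≡y)

∈-steps⇒∈-verts : ∀ {u ds w d} → (w , d) ∈ steps u ds → w ∈ verts u ds
∈-steps⇒∈-verts {u} {ds} m = subst (_ ∈_) (sym (verts≡map-steps u ds)) (∈-map⁺ proj₁ m)

∈-steps⇒∈-segs : ∀ {u ds w d} → (w , d) ∈ steps u ds → segOf d w ∈ segs u ds
∈-steps⇒∈-segs {u} {ds} m = subst (_ ∈_) (sym (segs≡map-steps u ds)) (∈-map⁺ stepSeg m)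

∈-segs⇒∈-steps : ∀ {u ds s} → s ∈ segs u ds → ∃ λ w → ∃ λ d → (w , d) ∈ steps u ds × segOf d w ≡ s
∈-segs⇒∈-steps {u} {ds} s∈ with ∈-map⁻ stepSeg (subst (_ ∈_) (segs≡map-steps u ds) s∈)
... | (w , d) , m , refl = w , d , m , refl

∈-steps⇒split : ∀ {u ds w d} → (w , d) ∈ steps u ds →
  ∃ λ xs → ∃ λ ys → ds ≡ xs ++ d ∷ ys × endpoint u xs ≡ w
∈-steps⇒split {ds = d ∷ ds} (here refl) = [] , ds , refl , refl
∈-steps⇒split {u} {d₀ ∷ ds} (there m) with ∈-steps⇒split {step d₀ u} {ds} m
... | xs , ys , refl , refl = d₀ ∷ xs , ys , refl , refl

∈-steps-∷ʳ⁻ : ∀ {u ds w d d′} → (w , d) ∈ steps u (ds ++ [ d′ ]) → d ≢ d′ → (w , d) ∈ steps u ds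
∈-steps-∷ʳ⁻ {u} {ds} {d′ = d′} m d≢d′ with ∈-++⁻ (steps u ds) (subst (_ ∈_) (steps-++ u ds [ d′ ]) m)
... | inj₁ m′          = m′
... | inj₂ (here refl) = ⊥-elim (d≢d′ refl)

start∈verts-∷ʳ : ∀ u ds d → u ∈ verts u (ds ++ [ d ])
start∈verts-∷ʳ u []      d = here refl
start∈verts-∷ʳ u (_ ∷ _) d = here refl

allVerts : Vertex → List Dir → List Vertex
allVerts u ds = verts u ds ++ [ endpoint u ds ]

start∈allVerts : ∀ u ds → u ∈ allVerts u ds
start∈allVerts u []      = here refl
start∈allVerts u (_ ∷ _) = here refl

∈-steps⇒step∈allVerts : ∀ {u ds w d} → (w , d) ∈ steps u ds → step d w ∈ allVerts u ds
∈-steps⇒step∈allVerts {u} {d ∷ []}      (here refl) = there (here refl)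
∈-steps⇒step∈allVerts {u} {d ∷ d′ ∷ ds} (here refl) = there (here refl)
∈-steps⇒step∈allVerts {u} {d₀ ∷ ds}     (there m)   = there (∈-steps⇒step∈allVerts {step d₀ u} {ds} m)

vert-injective : ∀ {i j i′ j′} → vert i j ≡ vert i′ j′ → i ≡ i′ × j ≡ j′
vert-injective refl = refl , refl

horz-injective : ∀ {i j i′ j′} → horz i j ≡ horz i′ j′ → i ≡ i′ × j ≡ j′
horz-injective refl = refl , refl

segOf-≡ : ∀ d w d′ w′ → segOf d w ≡ segOf d′ w′ → w ≡ w′ ⊎ w ≡ step d′ w′
segOf-≡ N _ N _ refl = inj₁ refl
segOf-≡ N _ S _ refl = inj₂ refl
segOf-≡ E _ E _ refl = inj₁ refl
segOf-≡ E _ W _ refl = inj₂ refl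
segOf-≡ S (x , _) N _ e with vert-injective e
... | refl , y-1≡y′   = inj₂ (cong (x ,_) (i-1≡j⇒i≡j+1 y-1≡y′))
segOf-≡ S (x , _) S _ e with vert-injective e
... | refl , y-1≡y′-1 = inj₁ (cong (x ,_) (-1-injective y-1≡y′-1))
segOf-≡ W (_ , y) E _ e with horz-injective e
... | x-1≡x′ , refl   = inj₂ (cong (_, y) (i-1≡j⇒i≡j+1 x-1≡x′))
segOf-≡ W (_ , y) W _ e with horz-injective e
... | x-1≡x′-1 , refl = inj₁ (cong (_, y) (-1-injective x-1≡x′-1))

segOf∈segs⇒∈allVerts : ∀ {u ds} d v → segOf d v ∈ segs u ds → v ∈ allVerts u ds
segOf∈segs⇒∈allVerts {u} {ds} d v m with ∈-segs⇒∈-steps m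
... | w , d′ , m′ , e with segOf-≡ d v d′ w (sym e)
...   | inj₁ refl = ∈-++⁺ˡ (∈-steps⇒∈-verts m′)
...   | inj₂ refl = ∈-steps⇒step∈allVerts m′

segOf∈segs⇒∈verts : ∀ {u ds} d v → endpoint u ds ≡ u → segOf d v ∈ segs u ds → v ∈ verts u ds
segOf∈segs⇒∈verts {u} {d₀ ∷ ds} d v closed m with ∈-++⁻ (verts u (d₀ ∷ ds)) (segOf∈segs⇒∈allVerts d v m)
... | inj₁ v∈          = v∈
... | inj₂ (here refl) = subst (_∈ verts u (d₀ ∷ ds)) (sym closed) (here refl)

cellSides : Vertex → List Seg
cellSides (x , y) = vert x y ∷ vert (x + 1ℤ) y ∷ horz x y ∷ horz x (y + 1ℤ) ∷ []

segOf∈cellSides-leftCell : ∀ d w → segOf d w ∈ cellSides (leftCell d w)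
segOf∈cellSides-leftCell N (x , y) = there (here (cong (λ i → vert i y) (sym (i-1+1≡i x))))
segOf∈cellSides-leftCell E (x , y) = there (there (here refl))
segOf∈cellSides-leftCell S (x , y) = here refl
segOf∈cellSides-leftCell W (x , y) = there (there (there (here (cong (horz (x - 1ℤ)) (sym (i-1+1≡i y))))))

leftCell-off : ∀ {u ds w d v} → (w , d) ∈ steps u ds → All (_∉ segs u ds) (cellSides v) → leftCell d w ≢ v
leftCell-off {w = w} {d} st off refl = All.lookup off (segOf∈cellSides-leftCell d w) (∈-steps⇒∈-segs st)

walk-east-length : ∀ x y ds → endpoint (x , y) ds ≡ (x + 1ℤ , y) →
  horz x y ∉ segs (x , y) ds → 2 ℕ.≤ length ds
walk-east-length x y []            e _ = ⊥-elim (i≢i+1 x (cong proj₁ e))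
walk-east-length x y (N ∷ [])      e _ = ⊥-elim (i≢i+1 x (cong proj₁ e))
walk-east-length x y (S ∷ [])      e _ = ⊥-elim (i≢i+1 x (cong proj₁ e))
walk-east-length x y (E ∷ [])      _ ∉ = ⊥-elim (∉ (here refl))
walk-east-length x y (W ∷ [])      e _ = ⊥-elim (i-1≢i+1 x (cong proj₁ e))
walk-east-length x y (_ ∷ _ ∷ _)   _ _ = s≤s (s≤s z≤n)

walk-west-length : ∀ x y ds → endpoint (x + 1ℤ , y) ds ≡ (x , y) →
  horz x y ∉ segs (x + 1ℤ , y) ds → 2 ℕ.≤ length ds
walk-west-length x y []            e _ = ⊥-elim (i+1≢i x (cong proj₁ e))
walk-west-length x y (N ∷ [])      e _ = ⊥-elim (i+1≢i x (cong proj₁ e))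
walk-west-length x y (S ∷ [])      e _ = ⊥-elim (i+1≢i x (cong proj₁ e))
walk-west-length x y (E ∷ [])      e _ = ⊥-elim (i+1+1≢i x (cong proj₁ e))
walk-west-length x y (W ∷ [])      _ ∉ = ⊥-elim (∉ (here (cong (λ i → horz i y) (sym (i+1-1≡i x)))))
walk-west-length x y (_ ∷ _ ∷ _)   _ _ = s≤s (s≤s z≤n)

-- Crossing parity

-- The vertical segment with lower end v crosses the eastward ray from the centre of the cell p
-- exactly when onRay p v.
onRay : Vertex → Vertex → Bool
onRay (x , y) (i , j) = does (j ≟ y) ∧ does (x <? i)

crossesRay : Vertex → Seg → Bool
crossesRay p (vert i j) = onRay p (i , j)
crossesRay _ (horz _ _) = false

parity : List Seg → Vertex → Bool
parity ss p = xorMap (crossesRay p) ss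

oddℕ-crossings : ∀ p ss → oddℕ (crossings p ss) ≡ parity ss p
oddℕ-crossings p       []              = refl
oddℕ-crossings (x , y) (vert i j ∷ ss) with does (j ≟ y) ∧ does (x <? i)
... | true  = cong not (oddℕ-crossings (x , y) ss)
... | false = oddℕ-crossings (x , y) ss
oddℕ-crossings p       (horz i j ∷ ss) = oddℕ-crossings p ss

InteriorCell-↭ : ∀ {ss ss′} p → ss ↭ ss′ → InteriorCell ss p → InteriorCell ss′ p
InteriorCell-↭ {ss} {ss′} p ss↭ss′ inside = begin
  oddℕ (crossings p ss′)  ≡⟨ oddℕ-crossings p ss′ ⟩
  parity ss′ p            ≡⟨ xorMap-↭ (crossesRay p) ss↭ss′ ⟨
  parity ss p             ≡⟨ oddℕ-crossings p ss ⟨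
  oddℕ (crossings p ss)   ≡⟨ inside ⟩
  true                    ∎
  where open ≡-Reasoning

Inside : List Seg → Vertex × Dir → Set
Inside ss vd = parity ss (stepLeftCell vd) ≡ true

parity-++ : ∀ xs ys p → parity (xs ++ ys) p ≡ parity xs p xor parity ys p
parity-++ xs ys p = xorMap-++ (crossesRay p) xs ys

parity-++-horz : ∀ ss i j p → parity (ss ++ [ horz i j ]) p ≡ parity ss p
parity-++-horz ss i j p = trans (parity-++ ss _ p) (xor-identityʳ (parity ss p))

parity-west : ∀ x y ss → vert x y ∉ ss → parity ss (x - 1ℤ , y) ≡ parity ss (x , y)
parity-west x y ss vert∉ss =
  xorMap-cong (All.tabulate λ {s} s∈ss → crossesRay-west s λ { refl → vert∉ss s∈ss })
  where
  crossesRay-west : ∀ s → s ≢ vert x y → crossesRay (x - 1ℤ , y) s ≡ crossesRay (x , y) s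
  crossesRay-west (horz _ _) _  = refl
  crossesRay-west (vert i j) s≢ with j ≟ y | i ≟ x
  ... | no _     | _        = refl
  ... | yes refl | yes refl = ⊥-elim (s≢ refl)
  ... | yes refl | no i≢x   = does-⇔ (mk⇔ to from) (x - 1ℤ <? i) (x <? i)
    where
    to : x - 1ℤ < i → x < i
    to x-1<i = ℤ.≤∧≢⇒< (<i+1⇒≤ (subst (_< i + 1ℤ) (i-1+1≡i x) (ℤ.+-monoˡ-< 1ℤ x-1<i))) (i≢x ∘′ sym)
    from : x < i → x - 1ℤ < i
    from = ℤ.<-trans (i-1<i x)

ColumnAtMost : ℤ → Seg → Set
ColumnAtMost X s = ∀ {i j} → s ≡ vert i j → i ≤ X

parity-east : ∀ {X x} y ss → All (ColumnAtMost X) ss → X ≤ x → parity ss (x , y) ≡ false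
parity-east {X} {x} y ss cols X≤x = xorMap-false (All.map (λ {s} → no-crossing s) cols)
  where
  no-crossing : ∀ s → ColumnAtMost X s → crossesRay (x , y) s ≡ false
  no-crossing (horz _ _) _    = refl
  no-crossing (vert i j) i≤X with x <? i
  ... | yes x<i = ⊥-elim (ℤ.<⇒≱ x<i (ℤ.≤-trans (i≤X refl) X≤x))
  ... | no _    = ∧-zeroʳ (does (j ≟ y))

isHorzAt : ℤ → ℤ → Seg → Bool
isHorzAt x y (horz i j) = does (i ≟ x) ∧ does (j ≟ y)
isHorzAt x y (vert _ _) = false

-- For each step, the change of crossing parity from the cell (x , y - 1) to the cell (x , y),
-- corrected by whether the step runs between them, is the change in whether the current vertex
-- lies on the ray from (x , y); around a closed walk this telescopes to zero.
parity-south : ∀ x y u ds → endpoint u ds ≡ u →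
  parity (segs u ds) (x , y - 1ℤ) xor parity (segs u ds) (x , y) ≡ xorMap (isHorzAt x y) (segs u ds)
parity-south x y u ds closed = xor≡false⇒≡ (begin
  (parity ss (x , y - 1ℤ) xor parity ss (x , y)) xor xorMap (isHorzAt x y) ss
    ≡⟨ cong (_xor xorMap (isHorzAt x y) ss) (xorMap-xor (crossesRay (x , y - 1ℤ)) (crossesRay (x , y)) ss) ⟨
  xorMap crossingChange ss xor xorMap (isHorzAt x y) ss
    ≡⟨ sym (xorMap-xor crossingChange (isHorzAt x y) ss) ⟩
  xorMap change ss
    ≡⟨ telescope u ds ⟩
  onRay (x , y) u xor onRay (x , y) (endpoint u ds)
    ≡⟨ cong (λ v → onRay (x , y) u xor onRay (x , y) v) closed ⟩
  onRay (x , y) u xor onRay (x , y) u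
    ≡⟨ xor-same (onRay (x , y) u) ⟩
  false ∎)
  where
  open ≡-Reasoning
  ss = segs u ds
  crossingChange change : Seg → Bool
  crossingChange s = crossesRay (x , y - 1ℤ) s xor crossesRay (x , y) s
  change s = crossingChange s xor isHorzAt x y s

  ray = onRay (x , y)

  change-step : ∀ d w → change (segOf d w) ≡ ray w xor ray (step d w)
  change-step N (i , j) = begin
    (does (j ≟ y - 1ℤ) ∧ does (x <? i) xor ray (i , j)) xor false
      ≡⟨ xor-identityʳ _ ⟩
    does (j ≟ y - 1ℤ) ∧ does (x <? i) xor ray (i , j)
      ≡⟨ cong (λ t → t ∧ does (x <? i) xor ray (i , j)) (does-≟-1 j y) ⟩
    ray (i , j + 1ℤ) xor ray (i , j)
      ≡⟨ xor-comm (ray (i , j + 1ℤ)) (ray (i , j)) ⟩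
    ray (i , j) xor ray (i , j + 1ℤ) ∎
  change-step S (i , j) = begin
    (does (j - 1ℤ ≟ y - 1ℤ) ∧ does (x <? i) xor ray (i , j - 1ℤ)) xor false
      ≡⟨ xor-identityʳ _ ⟩
    does (j - 1ℤ ≟ y - 1ℤ) ∧ does (x <? i) xor ray (i , j - 1ℤ)
      ≡⟨ cong (λ t → t ∧ does (x <? i) xor ray (i , j - 1ℤ)) (does-≟-pred j y) ⟩
    ray (i , j) xor ray (i , j - 1ℤ) ∎
  change-step E (i , j) = begin
    does (i ≟ x) ∧ does (j ≟ y)
      ≡⟨ ∧-comm (does (i ≟ x)) (does (j ≟ y)) ⟩
    does (j ≟ y) ∧ does (i ≟ x)
      ≡⟨ cong (does (j ≟ y) ∧_) (sym (<-xor-<+1 x i)) ⟩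
    does (j ≟ y) ∧ (does (x <? i) xor does (x <? i + 1ℤ))
      ≡⟨ ∧-distribˡ-xor (does (j ≟ y)) _ _ ⟩
    ray (i , j) xor ray (i + 1ℤ , j) ∎
  change-step W (i , j) = begin
    does (i - 1ℤ ≟ x) ∧ does (j ≟ y)
      ≡⟨ ∧-comm (does (i - 1ℤ ≟ x)) (does (j ≟ y)) ⟩
    does (j ≟ y) ∧ does (i - 1ℤ ≟ x)
      ≡⟨ cong (does (j ≟ y) ∧_) (sym (<-xor-<+1 x (i - 1ℤ))) ⟩
    does (j ≟ y) ∧ (does (x <? i - 1ℤ) xor does (x <? i - 1ℤ + 1ℤ))
      ≡⟨ cong (λ t → does (j ≟ y) ∧ (does (x <? i - 1ℤ) xor does (x <? t))) (i-1+1≡i i) ⟩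
    does (j ≟ y) ∧ (does (x <? i - 1ℤ) xor does (x <? i))
      ≡⟨ cong (does (j ≟ y) ∧_) (xor-comm (does (x <? i - 1ℤ)) (does (x <? i))) ⟩
    does (j ≟ y) ∧ (does (x <? i) xor does (x <? i - 1ℤ))
      ≡⟨ ∧-distribˡ-xor (does (j ≟ y)) _ _ ⟩
    ray (i , j) xor ray (i - 1ℤ , j) ∎

  telescope : ∀ u ds → xorMap change (segs u ds) ≡ ray u xor ray (endpoint u ds)
  telescope u []       = sym (xor-same (ray u))
  telescope u (d ∷ ds) =
    trans (cong₂ _xor_ (change-step d u) (telescope (step d u) ds))
          (xor-telescope (ray u) (ray (step d u)) (ray (endpoint (step d u) ds)))

isHorzAt≡true⇒≡ : ∀ x y s → isHorzAt x y s ≡ true → s ≡ horz x y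
isHorzAt≡true⇒≡ x y (horz i j) e with i ≟ x | j ≟ y
... | yes refl | yes refl = refl
isHorzAt≡true⇒≡ x y (horz i j) () | yes _ | no _
isHorzAt≡true⇒≡ x y (horz i j) () | no _  | _

xorMap-isHorzAt-∉ : ∀ x y ss → horz x y ∉ ss → xorMap (isHorzAt x y) ss ≡ false
xorMap-isHorzAt-∉ x y ss horz∉ss = xorMap-false (All.tabulate λ {s} s∈ss →
  ¬-not λ e → horz∉ss (subst (_∈ ss) (isHorzAt≡true⇒≡ x y s e) s∈ss))

xorMap-isHorzAt-∷ʳ : ∀ x y ss → horz x y ∉ ss → xorMap (isHorzAt x y) (ss ++ [ horz x y ]) ≡ true
xorMap-isHorzAt-∷ʳ x y ss horz∉ss
  rewrite xorMap-++ (isHorzAt x y) ss [ horz x y ] | xorMap-isHorzAt-∉ x y ss horz∉ss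
  with x ≟ x | y ≟ y
... | yes _ | yes _ = refl
... | no x≢x | _    = ⊥-elim (x≢x refl)
... | yes _ | no y≢y = ⊥-elim (y≢y refl)

parity-cellSides : ∀ x y px py → parity (cellSides (x , y)) (px , py) ≡ does (y ≟ py) ∧ does (x ≟ px)
parity-cellSides x y px py = begin
  ray (x , y) xor (ray (x + 1ℤ , y) xor false)
    ≡⟨ cong (ray (x , y) xor_) (xor-identityʳ (ray (x + 1ℤ , y))) ⟩
  does (y ≟ py) ∧ does (px <? x) xor does (y ≟ py) ∧ does (px <? x + 1ℤ)
    ≡⟨ ∧-distribˡ-xor (does (y ≟ py)) (does (px <? x)) (does (px <? x + 1ℤ)) ⟨
  does (y ≟ py) ∧ (does (px <? x) xor does (px <? x + 1ℤ))
    ≡⟨ cong (does (y ≟ py) ∧_) (<-xor-<+1 px x) ⟩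
  does (y ≟ py) ∧ does (x ≟ px) ∎
  where
  open ≡-Reasoning
  ray = onRay (px , py)

parity-cellSides-self : ∀ v → parity (cellSides v) v ≡ true
parity-cellSides-self (x , y) =
  trans (parity-cellSides x y x y) (cong₂ _∧_ (dec-true (y ≟ y) refl) (dec-true (x ≟ x) refl))

parity-cellSides-other : ∀ v p → p ≢ v → parity (cellSides v) p ≡ false
parity-cellSides-other (x , y) (px , py) p≢v
  rewrite parity-cellSides x y px py with y ≟ py | x ≟ px
... | yes refl | yes refl = ⊥-elim (p≢v refl)
... | yes _    | no _     = refl
... | no _     | _        = refl

-- Parity near a vertex off a closed walk

CellAround : Vertex → Vertex → Set
CellAround (x , y) p = p ≡ (x - 1ℤ , y - 1ℤ) ⊎ p ≡ (x , y - 1ℤ) ⊎ p ≡ (x - 1ℤ , y) ⊎ p ≡ (x , y)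

ConstantAround : (Vertex → Bool) → Vertex → Set
ConstantAround F v = ∀ p → CellAround v p → F p ≡ F v

leftCell-around : ∀ d u → CellAround u (leftCell d u)
leftCell-around N _ = inj₂ (inj₂ (inj₁ refl))
leftCell-around E _ = inj₂ (inj₂ (inj₂ refl))
leftCell-around S _ = inj₂ (inj₁ refl)
leftCell-around W _ = inj₁ refl

leftCell-around-step : ∀ d u → CellAround (step d u) (leftCell d u)
leftCell-around-step N (x , y) = inj₁ (cong (x - 1ℤ ,_) (sym (i+1-1≡i y)))
leftCell-around-step E (x , y) = inj₂ (inj₂ (inj₁ (cong (_, y) (sym (i+1-1≡i x)))))
leftCell-around-step S _       = inj₂ (inj₂ (inj₂ refl))
leftCell-around-step W _       = inj₂ (inj₁ refl)

parity-around : ∀ u ds → endpoint u ds ≡ u →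
  ∀ v → v ∉ verts u ds → ConstantAround (parity (segs u ds)) v
parity-around u ds closed (x , y) v∉ p p~v = around p~v
  where
  ss = segs u ds
  off : ∀ d → segOf d (x , y) ∉ ss
  off d m = v∉ (segOf∈segs⇒∈verts d (x , y) closed m)
  west : parity ss (x - 1ℤ , y) ≡ parity ss (x , y)
  west = parity-west x y ss (off N)
  south-west : parity ss (x - 1ℤ , y - 1ℤ) ≡ parity ss (x , y - 1ℤ)
  south-west = parity-west x (y - 1ℤ) ss (off S)
  south : parity ss (x , y - 1ℤ) ≡ parity ss (x , y)
  south = xor≡false⇒≡ (trans (parity-south x y u ds closed) (xorMap-isHorzAt-∉ x y ss (off E)))
  around : ∀ {p} → CellAround (x , y) p → parity ss p ≡ parity ss (x , y)
  around (inj₁ refl)               = trans south-west south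
  around (inj₂ (inj₁ refl))        = south
  around (inj₂ (inj₂ (inj₁ refl))) = west
  around (inj₂ (inj₂ (inj₂ refl))) = refl

leftCells-constant : ∀ (F : Vertex → Bool) u ds → (∀ v → v ∈ allVerts u ds → ConstantAround F v) →
  ∀ p → CellAround u p → All (λ vd → F (stepLeftCell vd) ≡ F p) (steps u ds)
leftCells-constant F u []       const p p~u = []
leftCells-constant F u (d ∷ ds) const p p~u =
  first ∷ All.map (λ e → trans e first)
    (leftCells-constant F (step d u) ds (λ v m → const v (there m))
                        (leftCell d u) (leftCell-around-step d u))
  where
  first : F (leftCell d u) ≡ F p
  first = trans (const u (here refl) _ (leftCell-around d u)) (sym (const u (here refl) p p~u))

-- The rightmost column

maxColumn : ℤ → List Seg → ℤ
maxColumn m []              = m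
maxColumn m (vert i _ ∷ ss) = i ⊔ maxColumn m ss
maxColumn m (horz _ _ ∷ ss) = maxColumn m ss

ColumnAtMost-weaken : ∀ {X Y} → X ≤ Y → ∀ {s} → ColumnAtMost X s → ColumnAtMost Y s
ColumnAtMost-weaken X≤Y col e = ℤ.≤-trans (col e) X≤Y

ColumnAtMost-maxColumn : ∀ m ss → All (ColumnAtMost (maxColumn m ss)) ss
ColumnAtMost-maxColumn m []              = []
ColumnAtMost-maxColumn m (vert i j ∷ ss) =
  (λ { refl → ℤ.i≤i⊔j i _ }) ∷ All.map (ColumnAtMost-weaken (ℤ.i≤j⊔i i _)) (ColumnAtMost-maxColumn m ss)
ColumnAtMost-maxColumn m (horz i j ∷ ss) = (λ ()) ∷ ColumnAtMost-maxColumn m ss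

maxColumn-attained : ∀ m ss → maxColumn m ss ≡ m ⊎ ∃ λ j → vert (maxColumn m ss) j ∈ ss
maxColumn-attained m []              = inj₁ refl
maxColumn-attained m (horz _ _ ∷ ss) with maxColumn-attained m ss
... | inj₁ e       = inj₁ e
... | inj₂ (j , m′) = inj₂ (j , there m′)
maxColumn-attained m (vert i j ∷ ss) with ℤ.⊔-sel i (maxColumn m ss)
... | inj₁ e = inj₂ (j , here (cong (λ k → vert k j) e))
... | inj₂ e with maxColumn-attained m ss
...   | inj₁ e′       = inj₁ (trans e e′)
...   | inj₂ (j′ , m′) = inj₂ (j′ , there (subst (λ k → vert k j′ ∈ ss) (sym e) m′))

-- Going south, the cell on the left would lie east of the whole curve.
rightmost-step-north : ∀ {X} ss y w d → All (ColumnAtMost X) ss →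
  parity ss (leftCell d w) ≡ true → segOf d w ≡ vert X y → w ≡ (X , y) × d ≡ N
rightmost-step-north ss y (x , y′) N cols ccw e with vert-injective e
... | refl , refl = refl , refl
rightmost-step-north ss y (x , y′) S cols ccw e with vert-injective e
... | refl , refl with () ← trans (sym ccw) (parity-east (y′ - 1ℤ) ss cols ℤ.≤-refl)

module _ {A : Set} where

  Unique-++⁻ˡ : ∀ (xs : List A) {ys} → Unique (xs ++ ys) → Unique xs
  Unique-++⁻ˡ []       _            = []
  Unique-++⁻ˡ (x ∷ xs) (x∉ ∷ uniq) = ++⁻ˡ xs x∉ ∷ Unique-++⁻ˡ xs uniq

  Unique-++⁻ʳ : ∀ (xs : List A) {ys} → Unique (xs ++ ys) → Unique ys
  Unique-++⁻ʳ []       uniq         = uniq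
  Unique-++⁻ʳ (x ∷ xs) (_ ∷ uniq)  = Unique-++⁻ʳ xs uniq

  Unique-++⇒Disjoint : ∀ (xs : List A) {ys} → Unique (xs ++ ys) → Disjoint xs ys
  Unique-++⇒Disjoint (x ∷ xs) (x∉ ∷ _) (here refl , v∈ys) = All.lookup (++⁻ʳ xs x∉) v∈ys refl
  Unique-++⇒Disjoint (x ∷ xs) (_ ∷ uniq) (there v∈xs , v∈ys) = Unique-++⇒Disjoint xs uniq (v∈xs , v∈ys)

module _ (s e : Vertex) (ds : List Dir) (d : Dir) (end : endpoint s ds ≡ e) where

  closeUp-verts : verts s (ds ++ [ d ]) ≡ verts s ds ++ [ e ]
  closeUp-verts = trans (verts-++ s ds [ d ]) (cong (λ v → verts s ds ++ [ v ]) end)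

  closeUp-segs : segs s (ds ++ [ d ]) ≡ segs s ds ++ [ segOf d e ]
  closeUp-segs = trans (segs-++ s ds [ d ]) (cong (λ v → segs s ds ++ [ segOf d v ]) end)

  closeUp-closed : step d e ≡ s → endpoint s (ds ++ [ d ]) ≡ s
  closeUp-closed back = trans (endpoint-++ s ds [ d ]) (trans (cong (step d) end) back)

  closeUp-steps : steps s (ds ++ [ d ]) ≡ steps s ds ++ [ (e , d) ]
  closeUp-steps = trans (steps-++ s ds [ d ]) (cong (λ v → steps s ds ++ [ (v , d) ]) end)

closeUp : ∀ {C} s e ds d → endpoint s ds ≡ e → step d e ≡ s → 2 ℕ.≤ length ds →
  Unique (verts s ds ++ [ e ]) → All C (segs s ds) → C (segOf d e) →
  All (Inside (segs s ds ++ [ segOf d e ])) (steps s ds ++ [ (e , d) ]) → Loop C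
closeUp s e ds d end back long uniq inC inCᵈ ccw = record
  { start    = s
  ; dirs     = ds ++ [ d ]
  ; long     = subst (3 ℕ.≤_) (sym (length-++ ds)) (ℕ.+-monoˡ-≤ 1 long)
  ; closed   = closeUp-closed s e ds d end back
  ; embedded = subst Unique (sym (closeUp-verts s e ds d end)) uniq
  ; inC      = subst (All _) (sym (closeUp-segs s e ds d end)) (++⁺ inC (inCᵈ ∷ []))
  ; ccw      = subst₂ (λ ss → All (λ vd → InteriorCell ss (stepLeftCell vd)))
                 (sym (closeUp-segs s e ds d end)) (sym (closeUp-steps s e ds d end))
                 (All.map (λ {vd} → trans (oddℕ-crossings (stepLeftCell vd) (segs s ds ++ [ segOf d e ])))
                          ccw)
  }

module _ {C} (L : Loop C) (xs ys : List Dir) (split : dirs L ≡ xs ++ ys) where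

  private
    s₀ r : Vertex
    s₀ = start L
    r  = endpoint s₀ xs

    ys-end : endpoint r ys ≡ s₀
    ys-end = trans (sym (endpoint-++ s₀ xs ys)) (trans (cong (endpoint s₀) (sym split)) (closed L))

  rotate-steps-↭ : steps r (ys ++ xs) ↭ steps s₀ (dirs L)
  rotate-steps-↭ = ↭-trans (↭-reflexive rotated)
                     (↭-trans (++-comm (steps r ys) (steps s₀ xs)) (↭-reflexive original))
    where
    rotated : steps r (ys ++ xs) ≡ steps r ys ++ steps s₀ xs
    rotated = trans (steps-++ r ys xs) (cong (λ v → steps r ys ++ steps v xs) ys-end)
    original : steps s₀ xs ++ steps r ys ≡ steps s₀ (dirs L)
    original = sym (trans (cong (steps s₀) split) (steps-++ s₀ xs ys))

  rotate-segs-↭ : segs r (ys ++ xs) ↭ segs s₀ (dirs L)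
  rotate-segs-↭ = subst₂ _↭_ (sym (segs≡map-steps r (ys ++ xs))) (sym (segs≡map-steps s₀ (dirs L)))
                    (map⁺ stepSeg rotate-steps-↭)

  rotate-verts-↭ : verts r (ys ++ xs) ↭ verts s₀ (dirs L)
  rotate-verts-↭ = subst₂ _↭_ (sym (verts≡map-steps r (ys ++ xs))) (sym (verts≡map-steps s₀ (dirs L)))
                     (map⁺ proj₁ rotate-steps-↭)

  rotate : Loop C
  rotate = record
    { start    = r
    ; dirs     = ys ++ xs
    ; long     = subst (3 ℕ.≤_) (trans (cong length split) (length-++-comm xs ys)) (long L)
    ; closed   = trans (endpoint-++ r ys xs) (cong (λ v → endpoint v xs) ys-end)
    ; embedded = Unique-resp-↭ (↭⇒↭ₛ (↭-sym rotate-verts-↭)) (embedded L)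
    ; inC      = All-resp-↭ (↭-sym rotate-segs-↭) (inC L)
    ; ccw      = All-resp-↭ (↭-sym rotate-steps-↭)
                   (All.map (λ {vd} → InteriorCell-↭ (stepLeftCell vd) (↭-sym rotate-segs-↭)) (ccw L))
    }

-- Agreeable loops

Agreeing : ℤ → Vertex × Dir → Set
Agreeing a vd = (∀ j → stepSeg vd ≡ vert a j → proj₂ vd ≡ S) ×
                (∀ j → stepSeg vd ≡ vert (a + 1ℤ) j → proj₂ vd ≡ N)

agreeing-west-step : ∀ {a u ds j} → All (Agreeing a) (steps u ds) →
  vert a j ∈ segs u ds → ((a , j + 1ℤ) , S) ∈ steps u ds
agreeing-west-step {a} {u} {ds} {j} agree m with ∈-segs⇒∈-steps m
... | (x , y) , d , m′ , e with proj₁ (All.lookup agree m′) j e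
... | refl with vert-injective e
... | refl , y-1≡j = subst (λ k → ((a , k) , S) ∈ steps u ds) (i-1≡j⇒i≡j+1 y-1≡j) m′

agreeing-east-step : ∀ {a u ds j} → All (Agreeing a) (steps u ds) →
  vert (a + 1ℤ) j ∈ segs u ds → ((a + 1ℤ , j) , N) ∈ steps u ds
agreeing-east-step agree m with ∈-segs⇒∈-steps m
... | (x , y) , d , m′ , e with proj₂ (All.lookup agree m′) _ e
... | refl with vert-injective e
... | refl , refl = m′

rotate-to-left-side : ∀ {C a b} (L : Loop C) → Agreeable a L → vert a b ∈ loopSegs L →
  Σ (Loop C) λ L′ → Agreeable a L′ × start L′ ≡ (a , b) ×
    (∃ λ ds → dirs L′ ≡ ds ++ [ S ]) × loopSegs L′ ↭ loopSegs L
rotate-to-left-side {a = a} {b} L agreeable left∈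
  with ∈-steps⇒split (agreeing-west-step agreeable left∈)
... | xs , ys , dirs≡ , xs-end =
  L′ , All-resp-↭ (↭-sym (rotate-steps-↭ L xs′ ys split)) agreeable , start≡ ,
  (ys ++ xs , sym (++-assoc ys xs [ S ])) , rotate-segs-↭ L xs′ ys split
  where
  xs′ : List Dir
  xs′ = xs ++ [ S ]
  split : dirs L ≡ xs′ ++ ys
  split = trans dirs≡ (sym (++-assoc xs [ S ] ys))
  L′ = rotate L xs′ ys split
  start≡ : endpoint (start L) xs′ ≡ (a , b)
  start≡ = trans (endpoint-++ (start L) xs [ S ]) (trans (cong (step S) xs-end) (cong (a ,_) (i+1-1≡i b)))

split-at-right-side : ∀ {C a b} (L : Loop C) → Agreeable a L → start L ≡ (a , b) →
  ∀ {ds} → dirs L ≡ ds ++ [ S ] → vert (a + 1ℤ) b ∈ loopSegs L →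
  ∃₂ λ P Q → dirs L ≡ P ++ N ∷ Q ++ [ S ] × endpoint (a , b) P ≡ (a + 1ℤ , b)
split-at-right-side {a = a} {b} L agreeable start≡ dirs≡ right∈
  with ∈-steps⇒split (∈-steps-∷ʳ⁻ (subst (λ ds → _ ∈ steps (start L) ds) dirs≡
                                          (agreeing-east-step agreeable right∈)) λ ())
... | P , Q , ds≡ , P-end =
  P , Q , trans dirs≡ (trans (cong (_++ [ S ]) ds≡) (++-assoc P (N ∷ Q) [ S ])) ,
  subst (λ u → endpoint u P ≡ (a + 1ℤ , b)) start≡ P-end

oddℕ-+1 : ∀ n → oddℕ (n ℕ.+ 1) ≡ not (oddℕ n)
oddℕ-+1 zero    = refl
oddℕ-+1 (suc n) = cong not (oddℕ-+1 n)

oddℤ-+1 : ∀ i → oddℤ (i + 1ℤ) ≡ not (oddℤ i)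
oddℤ-+1 (+ n)          = oddℕ-+1 n
oddℤ-+1 -[1+ zero ]    = refl
oddℤ-+1 -[1+ suc n ]   = sym (not-involutive (not (oddℕ n)))

stitch-alternates : ∀ H i j → Stitch H (vert i j) → ¬ Stitch H (vert i (j + 1ℤ))
stitch-alternates H i j st st′ = not-¬ refl (trans st (trans (sym st′) (oddℤ-+1 j)))

Config⇒¬Removed : ∀ {H a} {c : Choice H a} {i j} → Config c (vert i j) → ¬ Removed c (vert i j)
Config⇒¬Removed (inj₁ (_ , ¬removed))  = ¬removed
Config⇒¬Removed (inj₂ (_ , _ , inj₁ ()))
Config⇒¬Removed (inj₂ (_ , _ , inj₂ ()))

module _ {H a} (c : Choice H a) {b} (mv : MoveCell H a b) (left : Config c (vert a b)) where

  bottom∉Config : ¬ Config c (horz a b)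
  bottom∉Config (inj₁ (st , _))           = proj₁ (proj₂ (proj₂ mv)) st
  bottom∉Config (inj₂ (b′ , m , inj₁ e)) with horz-injective e
  ... | _ , refl = Config⇒¬Removed {c = c} left (b , inj₁ (m , inj₁ refl))
  bottom∉Config (inj₂ (b′ , m , inj₂ e)) with horz-injective e
  ... | _ , refl = stitch-alternates H a b′ (proj₁ (M-ok c b′ m)) (proj₁ mv)

  top∉Config : ¬ Config c (horz a (b + 1ℤ))
  top∉Config (inj₁ (st , _))           = proj₂ (proj₂ (proj₂ mv)) st
  top∉Config (inj₂ (b′ , m , inj₁ e)) with horz-injective e
  ... | _ , refl = stitch-alternates H a b (proj₁ mv) (proj₁ (M-ok c (b + 1ℤ) m))
  top∉Config (inj₂ (b′ , m , inj₂ e)) with horz-injective e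
  ... | _ , b+1≡b′+1 with +1-injective {b} {b′} b+1≡b′+1
  ...   | refl = Config⇒¬Removed {c = c} left (b , inj₁ (m , inj₁ refl))

Config-addMove : ∀ {H a} (c : Choice H a) {b} (mv : MoveCell H a b) {s} → Config c s →
  s ≢ vert a b → s ≢ vert (a + 1ℤ) b → Config (addMove c b mv) s
Config-addMove c mv (inj₁ (st , ¬removed)) s≢left s≢right = inj₁ (st , ¬removed′)
  where
  ¬removed′ : ¬ Removed (addMove c _ mv) _
  ¬removed′ (b′ , inj₁ (inj₁ m , side))         = ¬removed (b′ , inj₁ (m , side))
  ¬removed′ (b′ , inj₁ (inj₂ refl , inj₁ e))   = s≢left e
  ¬removed′ (b′ , inj₁ (inj₂ refl , inj₂ e))   = s≢right e
  ¬removed′ (b′ , inj₂ del)                     = ¬removed (b′ , inj₂ del)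
Config-addMove c mv (inj₂ (b′ , m , side)) _ _ = inj₂ (b′ , inj₁ m , side)

-- L starts at the lower-left corner u₀ of the cell, follows P to the lower-right corner v₀,
-- goes up the right side, follows Q from the upper-right corner u₁ to the upper-left corner v₁
-- and comes down the left side.
module Split {H a b} (c : Choice H a) (mv : MoveCell H a b)
  (L : Loop (Config c)) (agreeable : Agreeable a L) (P Q : List Dir)
  (start≡ : start L ≡ (a , b)) (dirs≡ : dirs L ≡ P ++ N ∷ Q ++ [ S ])
  (P-end : endpoint (a , b) P ≡ (a + 1ℤ , b)) where

  c′ : Choice H a
  c′ = addMove c b mv

  u₀ v₀ u₁ v₁ : Vertex
  u₀ = (a , b)
  v₀ = (a + 1ℤ , b)
  u₁ = (a + 1ℤ , b + 1ℤ)
  v₁ = (a , b + 1ℤ)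

  dirsL : List Dir
  dirsL = P ++ N ∷ Q ++ [ S ]

  onL : (F : Vertex → List Dir → Set) → F (start L) (dirs L) → F u₀ dirsL
  onL F = subst₂ F start≡ dirs≡

  Q-end : endpoint u₁ Q ≡ v₁
  Q-end = step-S≡ (begin
    step S (endpoint u₁ Q)                        ≡⟨ endpoint-++ u₁ Q [ S ] ⟨
    endpoint u₁ (Q ++ [ S ])                      ≡⟨ cong (λ v → endpoint v (N ∷ Q ++ [ S ])) P-end ⟨
    endpoint (endpoint u₀ P) (N ∷ Q ++ [ S ])     ≡⟨ endpoint-++ u₀ P (N ∷ Q ++ [ S ]) ⟨
    endpoint u₀ dirsL                             ≡⟨ onL (λ u ds → endpoint u ds ≡ u) (closed L) ⟩
    u₀                                            ∎)
    where open ≡-Reasoning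

  sP sQ : List Seg
  sP = segs u₀ P
  sQ = segs u₁ Q

  VP VQ : List Vertex
  VP = verts u₀ P ++ [ v₀ ]
  VQ = verts u₁ Q ++ [ v₁ ]

  LS : List Seg
  LS = sP ++ vert (a + 1ℤ) b ∷ sQ ++ [ vert a b ]

  steps-L : steps u₀ dirsL ≡ steps u₀ P ++ (v₀ , N) ∷ steps u₁ Q ++ [ (v₁ , S) ]
  steps-L rewrite walk-decompose steps steps-++ u₀ P N Q S | P-end | Q-end = refl

  verts-L : verts u₀ dirsL ≡ VP ++ VQ
  verts-L rewrite walk-decompose verts verts-++ u₀ P N Q S | P-end | Q-end =
    sym (++-assoc (verts u₀ P) [ v₀ ] VQ)

  segs-L : segs u₀ dirsL ≡ LS
  segs-L rewrite walk-decompose segs segs-++ u₀ P N Q S | P-end | Q-end =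
    cong (λ j → sP ++ vert (a + 1ℤ) b ∷ sQ ++ [ vert a j ]) (i+1-1≡i b)

  unique : Unique (VP ++ VQ)
  unique = subst Unique verts-L (onL (λ u ds → Unique (verts u ds)) (embedded L))

  unique-P : Unique VP
  unique-P = Unique-++⁻ˡ VP unique

  unique-Q : Unique VQ
  unique-Q = Unique-++⁻ʳ VP unique

  disjoint : Disjoint VP VQ
  disjoint = Unique-++⇒Disjoint VP unique

  inC-L : All (Config c) LS
  inC-L = subst (All (Config c)) segs-L (onL (λ u ds → All (Config c) (segs u ds)) (inC L))

  inC-P : All (Config c) sP
  inC-P = ++⁻ˡ sP inC-L

  inC-Q : All (Config c) sQ
  inC-Q = ++⁻ˡ sQ (All.tail (++⁻ʳ sP inC-L))

  left : Config c (vert a b)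
  left = All.head (++⁻ʳ sQ (All.tail (++⁻ʳ sP inC-L)))

  agree-L : All (Agreeing a) (steps u₀ P ++ (v₀ , N) ∷ steps u₁ Q ++ [ (v₁ , S) ])
  agree-L = subst (All (Agreeing a)) steps-L (onL (λ u ds → All (Agreeing a) (steps u ds)) agreeable)

  agree-P : All (Agreeing a) (steps u₀ P)
  agree-P = ++⁻ˡ (steps u₀ P) agree-L

  agree-Q : All (Agreeing a) (steps u₁ Q)
  agree-Q = ++⁻ˡ (steps u₁ Q) (All.tail (++⁻ʳ (steps u₀ P) agree-L))

  ccw-L : All (Inside LS) (steps u₀ P ++ (v₀ , N) ∷ steps u₁ Q ++ [ (v₁ , S) ])
  ccw-L = subst₂ (λ ss → All (Inside ss)) segs-L steps-L
    (All.map (λ {vd} → trans (sym (oddℕ-crossings (stepLeftCell vd) (segs u₀ dirsL))))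
      (onL (λ u ds → All (λ vd → InteriorCell (segs u ds) (stepLeftCell vd)) (steps u ds)) (ccw L)))

  ccw-P : All (Inside LS) (steps u₀ P)
  ccw-P = ++⁻ˡ (steps u₀ P) ccw-L

  ccw-Q : All (Inside LS) (steps u₁ Q)
  ccw-Q = ++⁻ˡ (steps u₁ Q) (All.tail (++⁻ʳ (steps u₀ P) ccw-L))

  ccw-cell : parity LS u₀ ≡ true
  ccw-cell = trans (cong (λ j → parity LS (a , j)) (sym (i+1-1≡i b)))
                   (All.head (++⁻ʳ (steps u₁ Q) (All.tail (++⁻ʳ (steps u₀ P) ccw-L))))

  bottom∉sP : horz a b ∉ sP
  bottom∉sP m = bottom∉Config c mv left (All.lookup inC-P m)

  bottom∉sQ : horz a b ∉ sQ
  bottom∉sQ m = bottom∉Config c mv left (All.lookup inC-Q m)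

  top∉sP : horz a (b + 1ℤ) ∉ sP
  top∉sP m = top∉Config c mv left (All.lookup inC-P m)

  top∉sQ : horz a (b + 1ℤ) ∉ sQ
  top∉sQ m = top∉Config c mv left (All.lookup inC-Q m)

  left∉sP : vert a b ∉ sP
  left∉sP m = disjoint ( ∈-++⁺ˡ (∈-steps⇒∈-verts (agreeing-west-step agree-P m))
                       , ∈-++⁺ʳ (verts u₁ Q) (here refl) )

  left∉sQ : vert a b ∉ sQ
  left∉sQ m = Unique-++⇒Disjoint (verts u₁ Q) unique-Q
                (∈-steps⇒∈-verts (agreeing-west-step agree-Q m) , here refl)

  right∉sP : vert (a + 1ℤ) b ∉ sP
  right∉sP m = Unique-++⇒Disjoint (verts u₀ P) unique-P
                 (∈-steps⇒∈-verts (agreeing-east-step agree-P m) , here refl)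

  right∉sQ : vert (a + 1ℤ) b ∉ sQ
  right∉sQ m = disjoint ( ∈-++⁺ʳ (verts u₀ P) (here refl)
                        , ∈-++⁺ˡ (∈-steps⇒∈-verts (agreeing-east-step agree-Q m)) )

  cell-off-P : All (_∉ sP) (cellSides u₀)
  cell-off-P = left∉sP ∷ right∉sP ∷ bottom∉sP ∷ top∉sP ∷ []

  cell-off-Q : All (_∉ sQ) (cellSides u₀)
  cell-off-Q = left∉sQ ∷ right∉sQ ∷ bottom∉sQ ∷ top∉sQ ∷ []

  parity-LS : ∀ p → parity LS p ≡ (parity sP p xor parity sQ p) xor parity (cellSides u₀) p
  parity-LS p = begin
    parity LS p
      ≡⟨ parity-++ sP _ p ⟩
    πP xor (r xor parity (sQ ++ [ vert a b ]) p)
      ≡⟨ cong (λ t → πP xor (r xor t)) (parity-++ sQ [ vert a b ] p) ⟩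
    πP xor (r xor (πQ xor (l xor false)))
      ≡⟨ cong (λ t → πP xor (r xor (πQ xor t))) (xor-identityʳ l) ⟩
    πP xor (r xor (πQ xor l))
      ≡⟨ cong (πP xor_) (xor-comm r (πQ xor l)) ⟩
    πP xor ((πQ xor l) xor r)
      ≡⟨ cong (πP xor_) (xor-assoc πQ l r) ⟩
    πP xor (πQ xor (l xor r))
      ≡⟨ xor-assoc πP πQ (l xor r) ⟨
    (πP xor πQ) xor (l xor r)
      ≡⟨ cong (λ t → (πP xor πQ) xor (l xor t)) (xor-identityʳ r) ⟨
    (πP xor πQ) xor parity (cellSides u₀) p ∎
    where
    open ≡-Reasoning
    πP = parity sP p
    πQ = parity sQ p
    r  = crossesRay p (vert (a + 1ℤ) b)
    l  = crossesRay p (vert a b)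

  parity-LS-off : ∀ p → p ≢ u₀ → parity LS p ≡ parity sP p xor parity sQ p
  parity-LS-off p p≢u₀ = trans (parity-LS p)
    (trans (cong ((parity sP p xor parity sQ p) xor_) (parity-cellSides-other u₀ p p≢u₀))
           (xor-identityʳ (parity sP p xor parity sQ p)))

  P₁ Q₁ : List Dir
  P₁ = P ++ [ W ]
  Q₁ = Q ++ [ E ]

  back-P : step W v₀ ≡ u₀
  back-P = cong (_, b) (i+1-1≡i a)

  closed-P₁ : endpoint u₀ P₁ ≡ u₀
  closed-P₁ = closeUp-closed u₀ v₀ P W P-end back-P

  closed-Q₁ : endpoint u₁ Q₁ ≡ u₁
  closed-Q₁ = closeUp-closed u₁ v₁ Q E Q-end refl

  segs-P₁ : segs u₀ P₁ ≡ sP ++ [ horz a b ]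
  segs-P₁ = trans (closeUp-segs u₀ v₀ P W P-end) (cong (λ i → sP ++ [ horz i b ]) (i+1-1≡i a))

  segs-Q₁ : segs u₁ Q₁ ≡ sQ ++ [ horz a (b + 1ℤ) ]
  segs-Q₁ = closeUp-segs u₁ v₁ Q E Q-end

  parity-P₁ : ∀ p → parity (segs u₀ P₁) p ≡ parity sP p
  parity-P₁ p = trans (cong (λ ss → parity ss p) segs-P₁) (parity-++-horz sP a b p)

  parity-Q₁ : ∀ p → parity (segs u₁ Q₁) p ≡ parity sQ p
  parity-Q₁ p = trans (cong (λ ss → parity ss p) segs-Q₁) (parity-++-horz sQ a (b + 1ℤ) p)

  verts-P₁ : verts u₀ P₁ ≡ VP
  verts-P₁ = closeUp-verts u₀ v₀ P W P-end

  verts-Q₁ : verts u₁ Q₁ ≡ VQ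
  verts-Q₁ = closeUp-verts u₁ v₁ Q E Q-end

  constant-sQ-along-P : ∀ v → v ∈ allVerts u₀ P → ConstantAround (parity sQ) v
  constant-sQ-along-P v v∈ p p~v = begin
    parity sQ p             ≡⟨ parity-Q₁ p ⟨
    parity (segs u₁ Q₁) p   ≡⟨ parity-around u₁ Q₁ closed-Q₁ v v∉ p p~v ⟩
    parity (segs u₁ Q₁) v   ≡⟨ parity-Q₁ v ⟩
    parity sQ v             ∎
    where
    open ≡-Reasoning
    v∉ : v ∉ verts u₁ Q₁
    v∉ m = disjoint (subst (v ∈_) (cong (λ e → verts u₀ P ++ [ e ]) P-end) v∈ , subst (v ∈_) verts-Q₁ m)

  constant-sP-along-Q : ∀ v → v ∈ allVerts u₁ Q → ConstantAround (parity sP) v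
  constant-sP-along-Q v v∈ p p~v = begin
    parity sP p             ≡⟨ parity-P₁ p ⟨
    parity (segs u₀ P₁) p   ≡⟨ parity-around u₀ P₁ closed-P₁ v v∉ p p~v ⟩
    parity (segs u₀ P₁) v   ≡⟨ parity-P₁ v ⟩
    parity sP v             ∎
    where
    open ≡-Reasoning
    v∉ : v ∉ verts u₀ P₁
    v∉ m = disjoint (subst (v ∈_) verts-P₁ m , subst (v ∈_) (cong (λ e → verts u₁ Q ++ [ e ]) Q-end) v∈)

  u₀-around-u₁ : CellAround u₁ u₀
  u₀-around-u₁ = inj₁ (cong₂ _,_ (sym (i+1-1≡i a)) (sym (i+1-1≡i b)))

  δP δQ : Bool
  δP = parity sP u₀
  δQ = parity sQ u₀

  along-P : All (λ vd → parity sQ (stepLeftCell vd) ≡ δQ) (steps u₀ P)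
  along-P = leftCells-constant (parity sQ) u₀ P constant-sQ-along-P u₀ (inj₂ (inj₂ (inj₂ refl)))

  along-Q : All (λ vd → parity sP (stepLeftCell vd) ≡ δP) (steps u₁ Q)
  along-Q = leftCells-constant (parity sP) u₁ Q constant-sP-along-Q u₀ u₀-around-u₁

  δP≡δQ : δP ≡ δQ
  δP≡δQ = xor≡false⇒≡ (xor-true≡true⇒≡false (trans (sym (trans (parity-LS u₀)
            (cong ((δP xor δQ) xor_) (parity-cellSides-self u₀)))) ccw-cell))

  X : ℤ
  X = maxColumn a LS

  cols : All (ColumnAtMost X) LS
  cols = ColumnAtMost-maxColumn a LS

  cols-P : All (ColumnAtMost X) sP
  cols-P = ++⁻ˡ sP cols

  cols-Q : All (ColumnAtMost X) sQ
  cols-Q = ++⁻ˡ sQ (All.tail (++⁻ʳ sP cols))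

  rightmost-north : ∀ {u ds y} → All (Inside LS) (steps u ds) →
    vert X y ∈ segs u ds → ((X , y) , N) ∈ steps u ds
  rightmost-north ccw m with ∈-segs⇒∈-steps m
  ... | w , d , st , e with rightmost-step-north LS _ w d cols (All.lookup ccw st) e
  ... | refl , refl = st

  rightmost-unshared : ∀ {y} → vert X y ∈ sP → vert X y ∉ sQ
  rightmost-unshared mP mQ = disjoint (∈-++⁺ˡ (∈-steps⇒∈-verts (rightmost-north ccw-P mP)) ,
                                       ∈-++⁺ˡ (∈-steps⇒∈-verts (rightmost-north ccw-Q mQ)))

  rightmost-in-P⇒δQ≡false : ∀ {y} → vert X y ∈ sP → δQ ≡ false
  rightmost-in-P⇒δQ≡false {y} m = begin
    δQ                      ≡⟨ All.lookup along-P (rightmost-north ccw-P m) ⟨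
    parity sQ (X - 1ℤ , y)  ≡⟨ parity-west X y sQ (rightmost-unshared m) ⟩
    parity sQ (X , y)       ≡⟨ parity-east y sQ cols-Q ℤ.≤-refl ⟩
    false                   ∎
    where open ≡-Reasoning

  rightmost-in-Q⇒δP≡false : ∀ {y} → vert X y ∈ sQ → δP ≡ false
  rightmost-in-Q⇒δP≡false {y} m = begin
    δP                      ≡⟨ All.lookup along-Q (rightmost-north ccw-Q m) ⟨
    parity sP (X - 1ℤ , y)  ≡⟨ parity-west X y sP (λ m′ → rightmost-unshared m′ m) ⟩
    parity sP (X , y)       ≡⟨ parity-east y sP cols-P ℤ.≤-refl ⟩
    false                   ∎
    where open ≡-Reasoning

  rightmost-≤⇒δP≡false : X ≤ a + 1ℤ → δP ≡ false
  rightmost-≤⇒δP≡false X≤a+1 = begin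
    parity sP (a , b)             ≡⟨ cong (λ i → parity sP (i , b)) (i+1-1≡i a) ⟨
    parity sP (a + 1ℤ - 1ℤ , b)   ≡⟨ parity-west (a + 1ℤ) b sP right∉sP ⟩
    parity sP (a + 1ℤ , b)        ≡⟨ parity-east b sP cols-P X≤a+1 ⟩
    false                         ∎
    where open ≡-Reasoning

  -- The cell left of the rightmost vertical segment of L is outside the other new loop.
  δP≡false : δP ≡ false
  δP≡false with maxColumn-attained a LS
  ... | inj₁ X≡a = rightmost-≤⇒δP≡false (ℤ.≤-trans (ℤ.≤-reflexive X≡a) (ℤ.<⇒≤ (i<i+1 a)))
  ... | inj₂ (y , m) with ∈-++⁻ sP m
  ...   | inj₁ m∈sP       = trans δP≡δQ (rightmost-in-P⇒δQ≡false m∈sP)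
  ...   | inj₂ (here e)   = rightmost-≤⇒δP≡false (ℤ.≤-reflexive (proj₁ (vert-injective e)))
  ...   | inj₂ (there m′) with ∈-++⁻ sQ m′
  ...     | inj₁ m∈sQ     = rightmost-in-Q⇒δP≡false m∈sQ
  ...     | inj₂ (here e) = rightmost-≤⇒δP≡false
                              (ℤ.≤-trans (ℤ.≤-reflexive (proj₁ (vert-injective e))) (ℤ.<⇒≤ (i<i+1 a)))

  δQ≡false : δQ ≡ false
  δQ≡false = trans (sym δP≡δQ) δP≡false

  inside-P : All (Inside sP) (steps u₀ P)
  inside-P = All.tabulate λ {(w , d)} st → let lc = leftCell d w in begin
    parity sP lc                    ≡⟨ xor-identityʳ (parity sP lc) ⟨
    parity sP lc xor false          ≡⟨ cong (parity sP lc xor_) (trans (All.lookup along-P st) δQ≡false) ⟨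
    parity sP lc xor parity sQ lc   ≡⟨ parity-LS-off lc (leftCell-off st cell-off-P) ⟨
    parity LS lc                    ≡⟨ All.lookup ccw-P st ⟩
    true                            ∎
    where open ≡-Reasoning

  inside-Q : All (Inside sQ) (steps u₁ Q)
  inside-Q = All.tabulate λ {(w , d)} st → let lc = leftCell d w in begin
    parity sQ lc                    ≡⟨ cong (_xor parity sQ lc) (trans (All.lookup along-Q st) δP≡false) ⟨
    parity sP lc xor parity sQ lc   ≡⟨ parity-LS-off lc (leftCell-off st cell-off-Q) ⟨
    parity LS lc                    ≡⟨ All.lookup ccw-Q st ⟩
    true                            ∎
    where open ≡-Reasoning

  below-bottom : parity sP (a , b - 1ℤ) ≡ true
  below-bottom = begin
    parity sP (a , b - 1ℤ)                               ≡⟨ xor-identityʳ _ ⟨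
    parity sP (a , b - 1ℤ) xor false                     ≡⟨ cong (parity sP (a , b - 1ℤ) xor_) δP≡false ⟨
    parity sP (a , b - 1ℤ) xor δP                        ≡⟨ cong₂ _xor_ (parity-P₁ _) (parity-P₁ u₀) ⟨
    parity sP₁ (a , b - 1ℤ) xor parity sP₁ u₀           ≡⟨ parity-south a b u₀ P₁ closed-P₁ ⟩
    xorMap (isHorzAt a b) sP₁                            ≡⟨ cong (xorMap (isHorzAt a b)) segs-P₁ ⟩
    xorMap (isHorzAt a b) (sP ++ [ horz a b ])           ≡⟨ xorMap-isHorzAt-∷ʳ a b sP bottom∉sP ⟩
    true                                                 ∎
    where
    open ≡-Reasoning
    sP₁ = segs u₀ P₁

  above-top : parity sQ v₁ ≡ true
  above-top = begin
    parity sQ v₁                                         ≡⟨ cong (_xor parity sQ v₁) δQ≡false ⟨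
    δQ xor parity sQ v₁
      ≡⟨ cong (λ j → parity sQ (a , j) xor parity sQ v₁) (i+1-1≡i b) ⟨
    parity sQ (a , b + 1ℤ - 1ℤ) xor parity sQ v₁         ≡⟨ cong₂ _xor_ (parity-Q₁ _) (parity-Q₁ v₁) ⟨
    parity sQ₁ (a , b + 1ℤ - 1ℤ) xor parity sQ₁ v₁      ≡⟨ parity-south a (b + 1ℤ) u₁ Q₁ closed-Q₁ ⟩
    xorMap (isHorzAt a (b + 1ℤ)) sQ₁                     ≡⟨ cong (xorMap (isHorzAt a (b + 1ℤ))) segs-Q₁ ⟩
    xorMap (isHorzAt a (b + 1ℤ)) (sQ ++ [ horz a (b + 1ℤ) ]) ≡⟨ xorMap-isHorzAt-∷ʳ a (b + 1ℤ) sQ top∉sQ ⟩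
    true                                                 ∎
    where
    open ≡-Reasoning
    sQ₁ = segs u₁ Q₁

  Inside-++-horz : ∀ ss i j {sts} → All (Inside ss) sts → All (Inside (ss ++ [ horz i j ])) sts
  Inside-++-horz ss i j = All.map λ {vd} → trans (parity-++-horz ss i j (stepLeftCell vd))

  L₁ : Loop (Config c′)
  L₁ = closeUp u₀ v₀ P W P-end back-P (walk-east-length a b P P-end bottom∉sP) unique-P
    (All.tabulate λ m → Config-addMove c mv (All.lookup inC-P m)
                          (λ e → left∉sP (subst (_∈ sP) e m)) (λ e → right∉sP (subst (_∈ sP) e m)))
    (inj₂ (b , inj₂ refl , inj₁ (cong (λ i → horz i b) (i+1-1≡i a))))
    (Inside-++-horz sP (a + 1ℤ - 1ℤ) b
      (++⁺ inside-P (subst (λ i → parity sP (i , b - 1ℤ) ≡ true) (sym (i+1-1≡i a)) below-bottom ∷ [])))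

  L₂ : Loop (Config c′)
  L₂ = closeUp u₁ v₁ Q E Q-end refl (walk-west-length a (b + 1ℤ) Q Q-end top∉sQ) unique-Q
    (All.tabulate λ m → Config-addMove c mv (All.lookup inC-Q m)
                          (λ e → left∉sQ (subst (_∈ sQ) e m)) (λ e → right∉sQ (subst (_∈ sQ) e m)))
    (inj₂ (b , inj₂ refl , inj₂ refl))
    (Inside-++-horz sQ a (b + 1ℤ) (++⁺ inside-Q (above-top ∷ [])))

  bottom∈L₁ : horz a b ∈ loopSegs L₁
  bottom∈L₁ = subst (horz a b ∈_) (sym segs-P₁) (∈-++⁺ʳ sP (here refl))

  top∈L₂ : horz a (b + 1ℤ) ∈ loopSegs L₂
  top∈L₂ = subst (horz a (b + 1ℤ) ∈_) (sym segs-Q₁) (∈-++⁺ʳ sQ (here refl))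

  bottom∉L₂ : horz a b ∉ loopSegs L₂
  bottom∉L₂ m with ∈-++⁻ sQ (subst (horz a b ∈_) segs-Q₁ m)
  ... | inj₁ m′       = bottom∉sQ m′
  ... | inj₂ (here e) = i≢i+1 b (proj₂ (horz-injective e))

  agreeable-L₁ : Agreeable a L₁
  agreeable-L₁ = subst (All (Agreeing a)) (sym (closeUp-steps u₀ v₀ P W P-end))
                   (++⁺ agree-P (((λ _ ()) , (λ _ ())) ∷ []))

  agreeable-L₂ : Agreeable a L₂
  agreeable-L₂ = subst (All (Agreeing a)) (sym (closeUp-steps u₁ v₁ Q E Q-end))
                   (++⁺ agree-Q (((λ _ ()) , (λ _ ())) ∷ []))

  L₁⊄L₂ : ¬ InInterior L₁ L₂
  L₁⊄L₂ L₁⊆L₂ = not-¬ δQ≡false (begin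
    δQ                              ≡⟨ parity-Q₁ u₀ ⟨
    parity (loopSegs L₂) u₀         ≡⟨ oddℕ-crossings u₀ (loopSegs L₂) ⟨
    oddℕ (crossings u₀ (loopSegs L₂)) ≡⟨ proj₂ (All.lookup L₁⊆L₂ (start∈verts-∷ʳ u₀ P W)) ⟩
    true                            ∎)
    where open ≡-Reasoning

  L₂⊄L₁ : ¬ InInterior L₂ L₁
  L₂⊄L₁ L₂⊆L₁ = not-¬ δP≡false (begin
    δP                              ≡⟨ constant-sP-along-Q u₁ (start∈allVerts u₁ Q) u₀ u₀-around-u₁ ⟩
    parity sP u₁                    ≡⟨ constant-sP-along-Q u₁ (start∈allVerts u₁ Q) v₁ v₁-around-u₁ ⟨
    parity sP v₁                    ≡⟨ parity-P₁ v₁ ⟨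
    parity (loopSegs L₁) v₁         ≡⟨ oddℕ-crossings v₁ (loopSegs L₁) ⟨
    oddℕ (crossings v₁ (loopSegs L₁)) ≡⟨ proj₂ (All.lookup L₂⊆L₁ v₁∈L₂) ⟩
    true                            ∎)
    where
    open ≡-Reasoning
    v₁-around-u₁ : CellAround u₁ v₁
    v₁-around-u₁ = inj₂ (inj₂ (inj₁ (cong (_, b + 1ℤ) (sym (i+1-1≡i a)))))
    v₁∈L₂ : v₁ ∈ loopVerts L₂
    v₁∈L₂ = subst (v₁ ∈_) (sym verts-Q₁) (∈-++⁺ʳ (verts u₁ Q) (here refl))

lemma4p4 : (H : Pattern) (a : ℤ) → ε H a ≡ ε H (a + 1ℤ) →
    (c : Choice H a) (L : Loop (Config c)) → Agreeable a L →
    (b : ℤ) (mv : MoveCell H a b) →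
    vert a b ∈ loopSegs L → vert (a + 1ℤ) b ∈ loopSegs L →
    Σ (Loop (Config (addMove c b mv))) λ L₁ →
    Σ (Loop (Config (addMove c b mv))) λ L₂ →
      horz a b ∈ loopSegs L₁ × horz a (b + 1ℤ) ∈ loopSegs L₂ ×
      horz a b ∉ loopSegs L₂ ×
      Agreeable a L₁ × Agreeable a L₂ ×
      ¬ InInterior L₁ L₂ × ¬ InInterior L₂ L₁
lemma4p4 H a _ c L agreeable b mv left∈ right∈
  with rotate-to-left-side L agreeable left∈
... | L′ , agreeable′ , start≡ , (_ , dirs≡) , segs↭
  with split-at-right-side L′ agreeable′ start≡ dirs≡ (∈-resp-↭ (↭-sym segs↭) right∈)
... | P , Q , dirs≡′ , P-end =
  L₁ , L₂ , bottom∈L₁ , top∈L₂ , bottom∉L₂ , agreeable-L₁ , agreeable-L₂ , L₁⊄L₂ , L₂⊄L₁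
  where open Split c mv L′ agreeable′ P Q start≡ dirs≡′ P-end
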